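{- Let $\alpha\in\Sigma^\omega$ be disjunctive, and suppose $\alpha(n)$ can be effectively computed given $n$. Then there is an algorithm which, given a deterministic finite Muller automaton $\mathcal{A}$ over $\Sigma$, decides whether $\mathcal{A}$ accepts $\alpha$.
   Context: An infinite word $\alpha$ over a finite alphabet $\Sigma$ is disjunctive if every finite word $u\in\Sigma^*$ occurs infinitely often in $\alpha$. A deterministic finite Muller automaton over $\Sigma$ is $(Q,q_{\mathrm{init}},\delta,\mathcal{F})$ with finite $Q$, $\delta\colon Q\times\Sigma\to Q$, $\mathcal{F}\subseteq 2^Q$; it accepts $\alpha$ iff the set of states occurring infinitely often in its run on $\alpha$ belongs to $\mathcal{F}$. -}

module Defs where

open import Data.Nat using (ℕ; zero; suc; _+_; _≤_)
open import Data.Fin using (Fin; toℕ)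
open import Data.Fin.Subset using (Subset; _∈_)
open import Data.List using (List; length; lookup)
open import Data.Bool using (Bool; true)
open import Data.Product using (Σ; ∃; _×_)
open import Function.Bundles using (_⇔_)
open import Relation.Binary.PropositionalEquality using (_≡_)

OccursAt : {k : ℕ} → (ℕ → Fin k) → List (Fin k) → ℕ → Set
OccursAt α u i = (j : Fin (length u)) → α (i + toℕ j) ≡ lookup u j

Disjunctive : {k : ℕ} → (ℕ → Fin k) → Set
Disjunctive {k} α = (u : List (Fin k)) → (N : ℕ) → ∃ λ i → N ≤ i × OccursAt α u i

record Muller (k : ℕ) : Set where
  field
    m     : ℕ
    qinit : Fin m
    δ     : Fin m → Fin k → Fin m
    𝓕     : Subset m → Bool

open Muller public

run : {k : ℕ} (A : Muller k) → (ℕ → Fin k) → ℕ → Fin (m A)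
run A α zero    = qinit A
run A α (suc n) = δ A (run A α n) (α n)

InfOften : {k : ℕ} (A : Muller k) → (ℕ → Fin k) → Fin (m A) → Set
InfOften A α q = (N : ℕ) → ∃ λ n → N ≤ n × run A α n ≡ q

Accepts : {k : ℕ} → Muller k → (ℕ → Fin k) → Set
Accepts A α = Σ (Subset (m A)) λ S →
  ((q : Fin (m A)) → (q ∈ S) ⇔ InfOften A α q) × (𝓕 A S ≡ true)

-- On a disjunctive input the run of a deterministic automaton reaches a recurrent state c,
-- one lying in a bottom strongly connected component: concatenating, one state at a time,
-- words that lead to recurrent states gives a single word along which every state passes
-- through a recurrent state, and this word occurs in α. From then on the run stays among the
-- states reachable from c, and the same synchronisation argument shows that each of them is
-- visited infinitely often. So the set of states occurring infinitely often is the reachable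
-- set of c, which is computable by saturation, and acceptance is decided by evaluating 𝓕 on it.
module Submission where

open import Defs
open import Data.Nat using (ℕ)
open import Data.Fin using (Fin)
open import Relation.Nullary using (Dec)

open import Data.Bool using (true)
open import Data.Bool.Properties using () renaming (_≟_ to _≟ᵇ_)
open import Data.Empty using (⊥-elim)
open import Data.Fin using () renaming (zero to fzero; suc to fsuc)
open import Data.Fin.Properties using (any?; _≟_)
open import Data.Fin.Subset using (Subset; _∈_; _⊆_; _⊂_; ⁅_⁆; ∣_∣)
open import Data.Fin.Subset.Properties
  using (_∈?_; _⊂?_; x∈⁅x⁆; x∈⁅y⁆⇒x≡y; ∣p∣≤n; p⊂q⇒∣p∣<∣q∣; ⊆-antisym)
open import Data.List using (List; []; _∷_; _++_; length; foldl; filter; allFin)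
open import Data.List.Properties using (foldl-++; ++-assoc; ++-identityʳ)
open import Data.List.Relation.Unary.All as All using (All; []; _∷_)
open import Data.List.Relation.Unary.All.Properties using (all-filter)
open import Data.List.Membership.Propositional.Properties using (∈-allFin; ∈-filter⁺)
open import Data.Nat using (zero; suc; _+_; _≤_; _<_; _∸_; z≤n)
open import Data.Nat.GeneralisedArithmetic using (fold)
open import Data.Nat.Induction using (<-wellFounded)
open import Data.Nat.Properties
  using (≤-trans; ≤-<-trans; n≮n; m≤m+n; m≤n+m; +-suc; +-identityʳ; m∸n+n≡m)
open import Data.Product using (∃; ∃₂; _×_; _,_)
open import Data.Sum using (_⊎_; inj₁; inj₂)
open import Data.Unit using (tt)
open import Data.Vec using (tabulate)
open import Data.Vec.Properties using ([]=⇒lookup; lookup⇒[]=; lookup∘tabulate)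
open import Function using (_∘_; _on_)
open import Function.Bundles using (_⇔_; mk⇔; Equivalence)
open import Function.Construct.Composition using (_⇔-∘_)
open import Induction.WellFounded using (Acc; acc)
open import Relation.Binary.Construct.On using (wellFounded)
open import Relation.Binary.PropositionalEquality using (_≡_; refl; sym; trans; cong; subst; module ≡-Reasoning)
open import Relation.Nullary using (yes; no; does; ¬_; contradiction)
open import Relation.Nullary.Decidable using (map; map′; dec-true; decidable-stable; _×-dec_; _⊎-dec_; ¬?)
open import Relation.Unary using (Decidable; U)
open import Relation.Unary.Properties using (U?)

open Equivalence using (to; from)

module _ {n : ℕ} where

  fromDecidable : {P : Fin n → Set} → Decidable P → Subset n
  fromDecidable P? = tabulate (does ∘ P?)

  ∈-fromDecidable : {P : Fin n → Set} (P? : Decidable P) {x : Fin n} → x ∈ fromDecidable P? ⇔ P x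
  ∈-fromDecidable P? {x} = mk⇔
    (λ x∈ → witness (P? x) (trans (sym (lookup∘tabulate _ x)) ([]=⇒lookup x∈)))
    (λ Px → lookup⇒[]= x _ (trans (lookup∘tabulate _ x) (dec-true (P? x) Px)))
    where
    witness : ∀ {A : Set} (A? : Dec A) → does A? ≡ true → A
    witness (yes a) _ = a

  ⊆∧⊄⇒⊇ : {S S′ : Subset n} → S ⊆ S′ → ¬ S ⊂ S′ → S′ ⊆ S
  ⊆∧⊄⇒⊇ {S} S⊆S′ S⊄S′ {x} x∈S′ with x ∈? S
  ... | yes x∈S = x∈S
  ... | no x∉S  = contradiction ((λ {y} → S⊆S′ {y}) , x , x∈S′ , x∉S) S⊄S′

module Saturation {n : ℕ} (f : Subset n → Subset n)
                  (f-inflationary : ∀ S → S ⊆ f S)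
                  (f-monotone : ∀ {S S′} → S ⊆ S′ → f S ⊆ f S′) where

  saturate : Subset n → Subset n
  saturate S = fold S f (suc n)

  ⊆-saturate : ∀ {S} → S ⊆ saturate S
  ⊆-saturate {S} = ⊆-fold (suc n)
    where
    ⊆-fold : ∀ j → S ⊆ fold S f j
    ⊆-fold zero    = λ x∈ → x∈
    ⊆-fold (suc j) = f-inflationary _ ∘ ⊆-fold j

  -- Each iteration either has stabilised or has added an element, so after n + 1 of them
  -- the second alternative would exceed the size of Fin n.
  stable-or-growing : ∀ S j → f (fold S f j) ⊆ fold S f j ⊎ j ≤ ∣ fold S f j ∣
  stable-or-growing S zero = inj₂ z≤n
  stable-or-growing S (suc j) with stable-or-growing S j
  ... | inj₁ stable = inj₁ (f-monotone stable)
  ... | inj₂ j≤∣Sⱼ∣ with fold S f j ⊂? fold S f (suc j)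
  ...   | yes Sⱼ⊂Sⱼ₊₁ = inj₂ (≤-<-trans j≤∣Sⱼ∣ (p⊂q⇒∣p∣<∣q∣ Sⱼ⊂Sⱼ₊₁))
  ...   | no Sⱼ⊄Sⱼ₊₁  = inj₁ (f-monotone (⊆∧⊄⇒⊇ (f-inflationary _) Sⱼ⊄Sⱼ₊₁))

  saturate-closed : ∀ S → f (saturate S) ⊆ saturate S
  saturate-closed S with stable-or-growing S (suc n)
  ... | inj₁ stable = stable
  ... | inj₂ n<∣S∣  = ⊥-elim (n≮n n (≤-trans n<∣S∣ (∣p∣≤n (saturate S))))

  saturate-least : (P : Fin n → Set) → (∀ {S} → (∀ {x} → x ∈ S → P x) → ∀ {x} → x ∈ f S → P x) →
                   ∀ {S} → (∀ {x} → x ∈ S → P x) → ∀ {x} → x ∈ saturate S → P x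
  saturate-least P f-preserves {S} S⊆P = fold⊆P (suc n)
    where
    fold⊆P : ∀ j {x} → x ∈ fold S f j → P x
    fold⊆P zero  = S⊆P
    fold⊆P (suc j) = f-preserves (fold⊆P j)

module Automaton {k n : ℕ} (δ : Fin n → Fin k → Fin n) where

  δ* : Fin n → List (Fin k) → Fin n
  δ* = foldl δ

  δ*-++ : ∀ s u v → δ* s (u ++ v) ≡ δ* (δ* s u) v
  δ*-++ = foldl-++ δ

  Reach : Fin n → Fin n → Set
  Reach p q = ∃ λ w → δ* p w ≡ q

  Reach-refl : ∀ {p} → Reach p p
  Reach-refl = [] , refl

  Reach-trans : ∀ {p q r} → Reach p q → Reach q r → Reach p r
  Reach-trans {p} (u , refl) (v , refl) = u ++ v , δ*-++ p u v

  Reach-step : ∀ {p s} a → Reach p s → Reach p (δ s a)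
  Reach-step a p⇝s = Reach-trans p⇝s (a ∷ [] , refl)

  Successor : Subset n → Fin n → Set
  Successor S x = x ∈ S ⊎ ∃ λ s → s ∈ S × ∃ λ a → δ s a ≡ x

  successor? : ∀ S → Decidable (Successor S)
  successor? S x = x ∈? S ⊎-dec any? λ s → s ∈? S ×-dec any? λ a → δ s a ≟ x

  step : Subset n → Subset n
  step S = fromDecidable (successor? S)

  ∈-step : ∀ {S x} → x ∈ step S ⇔ Successor S x
  ∈-step {S} = ∈-fromDecidable (successor? S)

  step-inflationary : ∀ S → S ⊆ step S
  step-inflationary S x∈S = from ∈-step (inj₁ x∈S)

  step-monotone : ∀ {S S′} → S ⊆ S′ → step S ⊆ step S′
  step-monotone S⊆S′ x∈ with to ∈-step x∈
  ... | inj₁ x∈S               = from ∈-step (inj₁ (S⊆S′ x∈S))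
  ... | inj₂ (s , s∈S , a , e) = from ∈-step (inj₂ (s , S⊆S′ s∈S , a , e))

  open Saturation step step-inflationary step-monotone

  reachable : Fin n → Subset n
  reachable p = saturate ⁅ p ⁆

  ∈-reachable : ∀ {p q} → q ∈ reachable p ⇔ Reach p q
  ∈-reachable {p} = mk⇔ (saturate-least (Reach p) step-sound start-sound) reached
    where
    start-sound : ∀ {x} → x ∈ ⁅ p ⁆ → Reach p x
    start-sound x∈⁅p⁆ with x∈⁅y⁆⇒x≡y p x∈⁅p⁆
    ... | refl = Reach-refl
    step-sound : ∀ {S} → (∀ {x} → x ∈ S → Reach p x) → ∀ {x} → x ∈ step S → Reach p x
    step-sound S⊆Reach x∈ with to ∈-step x∈
    ... | inj₁ x∈S                  = S⊆Reach x∈S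
    ... | inj₂ (s , s∈S , a , refl) = Reach-step a (S⊆Reach s∈S)
    δ*-closed : ∀ {s} w → s ∈ reachable p → δ* s w ∈ reachable p
    δ*-closed []      s∈ = s∈
    δ*-closed (a ∷ w) s∈ =
      δ*-closed w (saturate-closed _ (from ∈-step (inj₂ (_ , s∈ , a , refl))))
    reached : ∀ {q} → Reach p q → q ∈ reachable p
    reached (w , refl) = δ*-closed w (⊆-saturate (x∈⁅x⁆ p))

  reach? : ∀ p q → Dec (Reach p q)
  reach? p q = map ∈-reachable (q ∈? reachable p)

  Recurrent : Fin n → Set
  Recurrent c = ∀ q → Reach c q → Reach q c

  -- A non-recurrent state p reaches some q which does not reach back, and then the
  -- reachable set of q is strictly smaller than that of p.
  recurrent-reachable : ∀ p → ∃ λ w → Recurrent (δ* p w)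
  recurrent-reachable p = go p (wellFounded (∣_∣ ∘ reachable) <-wellFounded p)
    where
    go : ∀ p → Acc (_<_ on (∣_∣ ∘ reachable)) p → ∃ λ w → Recurrent (δ* p w)
    go p (acc smaller) with any? (λ q → reach? p q ×-dec ¬? (reach? q p))
    ... | no ¬escape = [] , λ q p⇝q →
          decidable-stable (reach? q p) λ q↛p → ¬escape (q , p⇝q , q↛p)
    ... | yes (_ , (u , refl) , q↛p) =
      let (w , recurrent) = go (δ* p u) (smaller shrinks)
      in u ++ w , subst Recurrent (sym (δ*-++ p u w)) recurrent
      where
      shrinks : ∣ reachable (δ* p u) ∣ < ∣ reachable p ∣
      shrinks = p⊂q⇒∣p∣<∣q∣
        ( (λ x∈ → from ∈-reachable (Reach-trans (u , refl) (to ∈-reachable x∈)))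
        , p , from ∈-reachable Reach-refl , q↛p ∘ to ∈-reachable )

  RemainsReachable : (Fin n → Set) → Fin n → Set
  RemainsReachable T s = ∀ v → ∃ λ w → T (δ* (δ* s v) w)

  Visits : (Fin n → Set) → Fin n → List (Fin k) → Set
  Visits T s W = ∃₂ λ u v → W ≡ u ++ v × T (δ* s u)

  Visits-++ : ∀ {T s W} V → Visits T s W → Visits T s (W ++ V)
  Visits-++ V (u , v , refl , T-hit) = u , v ++ V , ++-assoc u v V , T-hit

  synchronising-word : ∀ {T} (ss : List (Fin n)) → All (RemainsReachable T) ss →
                       ∃ λ W → All (λ s → Visits T s W) ss
  synchronising-word []       []                    = [] , []
  synchronising-word {T} (s ∷ ss) (T-reachable ∷ rest) =
    let (W , visits) = synchronising-word {T} ss rest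
        (w , T-hit)  = T-reachable W
    in W ++ w
     , (W ++ w , [] , sym (++-identityʳ _) , subst T (sym (δ*-++ s W w)) T-hit)
     ∷ All.map (Visits-++ {T} w) visits

module Runs {k : ℕ} (A : Muller k) (α : ℕ → Fin k) where

  open Automaton (δ A)

  run-reachable : ∀ {i j} → i ≤ j → Reach (run A α i) (run A α j)
  run-reachable {i} {j} i≤j =
    subst (Reach (run A α i) ∘ run A α) (m∸n+n≡m i≤j) (reach-after (j ∸ i))
    where
    reach-after : ∀ d → Reach (run A α i) (run A α (d + i))
    reach-after zero    = Reach-refl
    reach-after (suc d) = Reach-step (α (d + i)) (reach-after d)

  run-across-occurrence : ∀ u {v i} → OccursAt α (u ++ v) i →
                          run A α (i + length u) ≡ δ* (run A α i) u
  run-across-occurrence []      {i = i} _      = cong (run A α) (+-identityʳ i)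
  run-across-occurrence (a ∷ u) {v} {i} occurs = begin
    run A α (i + suc (length u))  ≡⟨ cong (run A α) (+-suc i (length u)) ⟩
    run A α (suc i + length u)    ≡⟨ run-across-occurrence u occurs-tail ⟩
    δ* (run A α (suc i)) u        ≡⟨ cong (λ b → δ* (δ A (run A α i) b) u) occurs-head ⟩
    δ* (run A α i) (a ∷ u)        ∎
    where
    open ≡-Reasoning
    occurs-head : α i ≡ a
    occurs-head = trans (cong α (sym (+-identityʳ i))) (occurs fzero)
    occurs-tail : OccursAt α (u ++ v) (suc i)
    occurs-tail j = trans (cong α (sym (+-suc i _))) (occurs (fsuc j))

module _ {k : ℕ} (A : Muller k) {α : ℕ → Fin k} (disjunctive : Disjunctive α) where

  open Automaton (δ A)
  open Runs A α

  -- A synchronising word for the states satisfying P occurs after time N + t.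
  visited-infinitely-often : ∀ {P T : Fin (m A) → Set} {t} → Decidable P →
                             (∀ {s} → P s → RemainsReachable T s) →
                             (∀ {i} → t ≤ i → P (run A α i)) →
                             ∀ N → ∃ λ i → N ≤ i × T (run A α i)
  visited-infinitely-often {P} {T} {t} P? T-reachable P-eventually N
    with synchronising-word {T} (filter P? (allFin (m A)))
                                (All.map T-reachable (all-filter P? (allFin (m A))))
  ... | W , visits with disjunctive W (N + t)
  ...   | i , N+t≤i , occurs
    with All.lookup visits
           (∈-filter⁺ P? (∈-allFin (run A α i)) (P-eventually (≤-trans (m≤n+m t N) N+t≤i)))
  ...     | u , v , refl , T-hit =
    i + length u ,
    ≤-trans (≤-trans (m≤m+n N t) N+t≤i) (m≤m+n i (length u)) ,
    subst T (sym (run-across-occurrence u occurs)) T-hit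

  recurrent-on-run : ∃ λ t → Recurrent (run A α t)
  recurrent-on-run =
    let (t , _ , recurrent) = visited-infinitely-often {P = U} {T = Recurrent} {t = 0} U?
                                (λ {s} _ v → recurrent-reachable (δ* s v)) (λ _ → tt) 0
    in t , recurrent

  Inf-reachable : ∃ λ c → ∀ q → Reach c q ⇔ InfOften A α q
  Inf-reachable with recurrent-on-run
  ... | t , recurrent = run A α t , λ q → mk⇔ (visited q) (reached q)
    where
    visited : ∀ q → Reach (run A α t) q → InfOften A α q
    visited q c⇝q = visited-infinitely-often {T = _≡ q} {t = t} (reach? (run A α t))
      (λ c⇝s v → Reach-trans (recurrent (δ* _ v) (Reach-trans c⇝s (v , refl))) c⇝q) run-reachable
    reached : ∀ q → InfOften A α q → Reach (run A α t) q
    reached q infinitely-often =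
      let (i , t≤i , run≡q) = infinitely-often t
      in subst (Reach (run A α t)) run≡q (run-reachable t≤i)

accepts? : ∀ {k} (A : Muller k) {α : ℕ → Fin k} (S : Subset (m A)) →
           (∀ q → q ∈ S ⇔ InfOften A α q) → Dec (Accepts A α)
accepts? A S S⇔Inf = map′ (λ S∈𝓕 → S , S⇔Inf , S∈𝓕) S′∈𝓕⇒S∈𝓕 (𝓕 A S ≟ᵇ true)
  where
  S′∈𝓕⇒S∈𝓕 : Accepts A _ → 𝓕 A S ≡ true
  S′∈𝓕⇒S∈𝓕 (S′ , S′⇔Inf , S′∈𝓕) = subst (λ X → 𝓕 A X ≡ true) S′≡S S′∈𝓕
    where
    S′≡S : S′ ≡ S
    S′≡S = ⊆-antisym (λ {q} q∈ → from (S⇔Inf q) (to (S′⇔Inf q) q∈))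
                     (λ {q} q∈ → from (S′⇔Inf q) (to (S⇔Inf q) q∈))

theorem3p5 : (k : ℕ) (α : ℕ → Fin k) → Disjunctive α →
    (A : Muller k) → Dec (Accepts A α)
theorem3p5 k α disjunctive A =
  let (c , Reach⇔Inf) = Inf-reachable A disjunctive
      open Automaton (δ A)
  in accepts? A (reachable c) (λ q → Reach⇔Inf q ⇔-∘ ∈-reachable)
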